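{- For every $n\ge1$, the number of $B$-arc permutations in $B_n$ is $n2^n$.
   Context: $B_n$ is the group of bijections $\pi$ of $\{\pm1,\dots,\pm n\}$ with $\pi(-a)=-\pi(a)$, written $\pi=[\pi(1),\dots,\pi(n)]$. Let $\mathcal{O}_n$ be a circle with $2n$ points labeled $-1,-2,\dots,-n,1,2,\dots,n$ in clockwise order (equivalently, identify $j$ with $j\in\mathbb{Z}_{2n}$ and $-j$ with $n+j\in\mathbb{Z}_{2n}$ for $1\le j\le n$); an interval in $\mathcal{O}_n$ is a set of cyclically consecutive points. $\pi\in B_n$ is a $B$-arc permutation if for every $1\le j\le n$ the suffix set $\{\pi(j),\pi(j+1),\dots,\pi(n)\}$ is an interval in $\mathcal{O}_n$. -}

module Defs where

open import Data.Nat using (ℕ; zero; suc; _+_; _*_; _∸_; _≤_; _<_; _≤ᵇ_)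
open import Data.Integer using (ℤ; +_; -[1+_]; ∣_∣)
open import Data.Fin using (Fin; toℕ)
open import Data.Vec using (Vec; lookup)
open import Data.Bool using (if_then_else_)
open import Data.Product using (Σ; ∃; _×_)
open import Function.Bundles using (_⇔_)
open import Relation.Binary.PropositionalEquality using (_≡_)

-- Elements of ±[n] are represented by integers p with 1 ≤ |p| ≤ n.
IsPoint : ℕ → ℤ → Set
IsPoint n p = 1 ≤ ∣ p ∣ × ∣ p ∣ ≤ n

-- A signed permutation π ∈ B_n is represented by its window
-- [π(1),…,π(n)] (π(-a) = -π(a) determines the rest).
IsSignedPerm : (n : ℕ) → Vec ℤ n → Set
IsSignedPerm n w =
  (∀ i → IsPoint n (lookup w i)) ×
  (∀ i j → ∣ lookup w i ∣ ≡ ∣ lookup w j ∣ → i ≡ j)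

-- Position of a point on the circle O_n, as a representative in {1,…,2n}
-- of Z_{2n}: j ↦ j, -j ↦ n + j  (so -n ↦ 2n ≡ 0).
pos : ℕ → ℤ → ℕ
pos n (+ k)      = k
pos n -[1+ k ]   = n + suc k

-- clockwise distance from position s to position q (both in 1..2n), in 0..2n-1
offset : ℕ → ℕ → ℕ → ℕ
offset n s q = if s ≤ᵇ q then q ∸ s else q + 2 * n ∸ s

-- A set S of points of O_n is an interval (cyclically consecutive points):
-- it consists of the k consecutive points starting at position s.
IsInterval : (n : ℕ) → (ℤ → Set) → Set
IsInterval n S =
  Σ ℕ λ s → Σ ℕ λ k →
    1 ≤ s × s ≤ 2 * n × k ≤ 2 * n ×
    (∀ p → IsPoint n p → (S p ⇔ offset n s (pos n p) < k))

-- the suffix set {π(j), π(j+1), …, π(n)} (j as a Fin n index, 0-based)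
Suffix : (n : ℕ) → Vec ℤ n → Fin n → ℤ → Set
Suffix n w j p = ∃ λ i → toℕ j ≤ toℕ i × lookup w i ≡ p

IsBArc : (n : ℕ) → Vec ℤ n → Set
IsBArc n w = ∀ (j : Fin n) → IsInterval n (Suffix n w j)

module Submission where

-- A point of the circle O_n is identified with its position modulo N = 2n.  Read
-- backwards, a B-arc permutation grows an arc of O_n one point at a time: its last
-- entry (the centre) is any of the N points, and every earlier entry extends the arc
-- of the later ones by one point, clockwise or counterclockwise.  Since the arc has
-- at most n points it never holds both a and -a, so every such growth is a signed
-- permutation.  Hence B-arc permutations correspond to pairs (centre, choice vector
-- in Bool^(n-1)), and there are 2n·2^(n-1) = n·2^n of them.

open import Defs
open import Data.Nat
  using (ℕ; zero; suc; _+_; _*_; _∸_; _^_; _≤_; _<_; _<?_; _<ᵇ_; _≤ᵇ_; z≤n; s≤s; s≤s⁻¹; z<s; NonZero)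
open import Data.Nat.Properties
open import Data.Nat.DivMod
  using (_%_; %-distribˡ-+; m%n%n≡m%n; m<n⇒m%n≡m; n%n≡0; [m+n]%n≡m%n; m%n<n; m%n≤n;
         m≤n⇒[n∸m]%m≡n%m; m∣n⇒o%n%m≡o%m)
open import Data.Nat.Divisibility using (n∣m*n)
open import Data.Integer using (ℤ; -[1+_]; ∣_∣)
import Data.Integer as ℤ
open import Data.Bool using (Bool; true; false)
open import Data.Fin using (Fin; zero; suc; toℕ; fromℕ; fromℕ<)
import Data.Fin.Properties as Fin
open import Data.Vec using (Vec; []; _∷_; lookup; map)
open import Data.Vec.Properties using (lookup-map)
open import Data.List using (List; length)
import Data.List as List
import Data.List.Properties as List
open import Data.List.Membership.Propositional.Properties
  using (∈-++⁺ˡ; ∈-++⁺ʳ; ∈-map⁺; ∈-map⁻; ∈-cartesianProductWith⁺; ∈-cartesianProductWith⁻; ∈-allFin)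
open import Data.List.Relation.Unary.Any using (here)
import Data.List.Relation.Unary.Unique.Propositional.Properties as Unique
import Data.List.Relation.Unary.All as All
import Data.List.Relation.Unary.AllPairs as AllPairs
open import Data.List.Relation.Unary.Unique.Propositional using (Unique)
open import Data.List.Membership.Propositional using (_∈_)
open import Data.Product using (Σ; ∃; _×_; _,_; proj₂)
open import Data.Sum using (_⊎_; inj₁; inj₂; [_,_]′)
open import Data.Sum.Function.Propositional using (_⊎-⇔_)
open import Function using (_∘_)
open import Data.Empty using (⊥-elim)
open import Function.Bundles using (_⇔_; mk⇔; Equivalence)
import Function.Properties.Equivalence as ⇔
open import Relation.Nullary using (¬_; yes; no)
open import Relation.Nullary.Reflects using (ofʸ; ofⁿ)
open import Relation.Binary.PropositionalEquality
open import Algebra.Properties.CommutativeSemigroup +-commutativeSemigroup using (x∙yz≈y∙xz; xy∙z≈xz∙y)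

module _ (d : ℕ) .{{_ : NonZero d}} where

  %-absorbˡ : ∀ x y → (x % d + y) % d ≡ (x + y) % d
  %-absorbˡ x y = begin
    (x % d + y) % d              ≡⟨ %-distribˡ-+ (x % d) y d ⟩
    (x % d % d + y % d) % d      ≡⟨ cong (λ z → (z + y % d) % d) (m%n%n≡m%n x d) ⟩
    (x % d + y % d) % d          ≡⟨ %-distribˡ-+ x y d ⟨
    (x + y) % d                  ∎
    where open ≡-Reasoning

  %-absorbʳ : ∀ x y → (x + y % d) % d ≡ (x + y) % d
  %-absorbʳ x y = begin
    (x + y % d) % d  ≡⟨ cong (_% d) (+-comm x (y % d)) ⟩
    (y % d + x) % d  ≡⟨ %-absorbˡ y x ⟩
    (y + x) % d      ≡⟨ cong (_% d) (+-comm y x) ⟩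
    (x + y) % d      ∎
    where open ≡-Reasoning

  %-cong-+ˡ : ∀ c {x y} → x % d ≡ y % d → (c + x) % d ≡ (c + y) % d
  %-cong-+ˡ c {x} {y} e = begin
    (c + x) % d      ≡⟨ %-absorbʳ c x ⟨
    (c + x % d) % d  ≡⟨ cong (λ z → (c + z) % d) e ⟩
    (c + y % d) % d  ≡⟨ %-absorbʳ c y ⟩
    (c + y) % d      ∎
    where open ≡-Reasoning

  -- ... and reflected by it: adding d ∸ c % d undoes adding c.
  %-cancel-+ˡ : ∀ c {x y} → (c + x) % d ≡ (c + y) % d → x % d ≡ y % d
  %-cancel-+ˡ c {x} {y} e = trans (sym (undo x)) (trans (%-cong-+ˡ t e) (undo y))
    where
      t = d ∸ c % d
      t+c≡0 : (t + c) % d ≡ 0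
      t+c≡0 = begin
        (t + c) % d      ≡⟨ %-absorbʳ t c ⟨
        (t + c % d) % d  ≡⟨ cong (_% d) (m∸n+n≡m (m%n≤n c d)) ⟩
        d % d            ≡⟨ n%n≡0 d ⟩
        0                ∎
        where open ≡-Reasoning
      undo : ∀ z → (t + (c + z)) % d ≡ z % d
      undo z = begin
        (t + (c + z)) % d    ≡⟨ cong (_% d) (+-assoc t c z) ⟨
        (t + c + z) % d      ≡⟨ %-absorbˡ (t + c) z ⟨
        ((t + c) % d + z) % d ≡⟨ cong (λ w → (w + z) % d) t+c≡0 ⟩
        z % d                ∎
        where open ≡-Reasoning

  %-wrap : ∀ {z} → d ≤ z → z < d + d → z % d ≡ z ∸ d
  %-wrap {z} d≤z z<2d = begin
    z % d        ≡⟨ m≤n⇒[n∸m]%m≡n%m d≤z ⟨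
    (z ∸ d) % d  ≡⟨ m<n⇒m%n≡m (m<n+o⇒m∸n<o z d z<2d) ⟩
    z ∸ d        ∎
    where open ≡-Reasoning

  nonzero-residue : ∀ {z} → 0 < z → z < d → ¬ z % d ≡ 0
  nonzero-residue 0<z z<d z%d≡0 = <⇒≢ 0<z (sym (trans (sym (m<n⇒m%n≡m z<d)) z%d≡0))

  %-injective-pos : ∀ {x y} → 0 < x → x ≤ d → 0 < y → y ≤ d → x % d ≡ y % d → x ≡ y
  %-injective-pos {x} {y} 0<x x≤d 0<y y≤d e with m≤n⇒m<n∨m≡n x≤d | m≤n⇒m<n∨m≡n y≤d
  ... | inj₁ x<d | inj₁ y<d = trans (sym (m<n⇒m%n≡m x<d)) (trans e (m<n⇒m%n≡m y<d))
  ... | inj₂ x≡d | inj₂ y≡d = trans x≡d (sym y≡d)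
  ... | inj₁ x<d | inj₂ refl = ⊥-elim (nonzero-residue 0<x x<d (trans e (n%n≡0 d)))
  ... | inj₂ refl | inj₁ y<d = ⊥-elim (nonzero-residue 0<y y<d (trans (sym e) (n%n≡0 d)))

Occurs : ∀ {A : Set} {k} → Vec A k → A → Set
Occurs v x = ∃ λ i → lookup v i ≡ x

SuffixOf : ∀ {A : Set} {k} → Vec A k → Fin k → A → Set
SuffixOf v j x = ∃ λ i → toℕ j ≤ toℕ i × lookup v i ≡ x

Distinct : ∀ {A : Set} {k} → Vec A k → Set
Distinct v = ∀ i j → lookup v i ≡ lookup v j → i ≡ j

map-inverse : ∀ {A B : Set} {k} {f : A → B} {g : B → A} (v : Vec A k) →
  (∀ i → g (f (lookup v i)) ≡ lookup v i) → map g (map f v) ≡ v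
map-inverse []       _   = refl
map-inverse (x ∷ xs) g∘f = cong₂ _∷_ (g∘f zero) (map-inverse xs (g∘f ∘ suc))

module _ {A : Set} where

  occurs-cons : ∀ {k x y} {v : Vec A k} → Occurs (y ∷ v) x ⇔ (x ≡ y ⊎ Occurs v x)
  occurs-cons = mk⇔ to from
    where
      to : ∀ {k x y} {v : Vec A k} → Occurs (y ∷ v) x → x ≡ y ⊎ Occurs v x
      to (zero , y≡x)  = inj₁ (sym y≡x)
      to (suc i , e)   = inj₂ (i , e)
      from : ∀ {k x y} {v : Vec A k} → x ≡ y ⊎ Occurs v x → Occurs (y ∷ v) x
      from (inj₁ x≡y)    = zero , sym x≡y
      from (inj₂ (i , e)) = suc i , e

  suffix-zero : ∀ {k x} {v : Vec A (suc k)} → SuffixOf v zero x ⇔ Occurs v x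
  suffix-zero = mk⇔ (λ (i , _ , e) → i , e) (λ (i , e) → i , z≤n , e)

  suffix-suc : ∀ {k x y j} {v : Vec A k} → SuffixOf (y ∷ v) (suc j) x ⇔ SuffixOf v j x
  suffix-suc = mk⇔ (λ { (suc i , s≤s j≤i , e) → i , j≤i , e }) (λ (i , j≤i , e) → suc i , s≤s j≤i , e)

  distinct-tail : ∀ {k y} {v : Vec A k} → Distinct (y ∷ v) → Distinct v
  distinct-tail dist i j e = Fin.suc-injective (dist (suc i) (suc j) e)

  distinct-head : ∀ {k y} {v : Vec A k} → Distinct (y ∷ v) → ¬ Occurs v y
  distinct-head dist (i , e) with dist (suc i) zero e
  ... | ()

boolVecs : ∀ k → List (Vec Bool k)
boolVecs zero    = List.[ [] ]
boolVecs (suc k) = List.map (true ∷_) (boolVecs k) List.++ List.map (false ∷_) (boolVecs k)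

boolVecs-complete : ∀ {k} (bs : Vec Bool k) → bs ∈ boolVecs k
boolVecs-complete []           = here refl
boolVecs-complete (true ∷ bs)  = ∈-++⁺ˡ (∈-map⁺ (true ∷_) (boolVecs-complete bs))
boolVecs-complete {suc k} (false ∷ bs) =
  ∈-++⁺ʳ (List.map (true ∷_) (boolVecs k)) (∈-map⁺ (false ∷_) (boolVecs-complete bs))

boolVecs-unique : ∀ k → Unique (boolVecs k)
boolVecs-unique zero    = All.[] AllPairs.∷ AllPairs.[]
boolVecs-unique (suc k) =
  Unique.++⁺ (Unique.map⁺ ∷-injectiveʳ (boolVecs-unique k)) (Unique.map⁺ ∷-injectiveʳ (boolVecs-unique k)) disjoint
  where
    ∷-injectiveʳ : ∀ {b} {x y : Vec Bool k} → b ∷ x ≡ b ∷ y → x ≡ y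
    ∷-injectiveʳ refl = refl
    disjoint : ∀ {v} → ¬ (v ∈ List.map (true ∷_) (boolVecs k) × v ∈ List.map (false ∷_) (boolVecs k))
    disjoint (v∈true , v∈false) with ∈-map⁻ (true ∷_) v∈true | ∈-map⁻ (false ∷_) v∈false
    ... | _ , _ , refl | _ , _ , ()

boolVecs-length : ∀ k → length (boolVecs k) ≡ 2 ^ k
boolVecs-length zero    = refl
boolVecs-length (suc k) = begin
  length (ts List.++ fs)                     ≡⟨ List.length-++ ts ⟩
  length ts + length fs                      ≡⟨ cong₂ _+_ (List.length-map (true ∷_) (boolVecs k))
                                                          (List.length-map (false ∷_) (boolVecs k)) ⟩
  length (boolVecs k) + length (boolVecs k)  ≡⟨ cong (λ l → l + l) (boolVecs-length k) ⟩
  2 ^ k + 2 ^ k                              ≡⟨ cong (2 ^ k +_) (+-identityʳ (2 ^ k)) ⟨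
  2 ^ suc k                                  ∎
  where
    ts = List.map (true ∷_) (boolVecs k)
    fs = List.map (false ∷_) (boolVecs k)
    open ≡-Reasoning

length-cartesianProductWith : ∀ {A B C : Set} (f : A → B → C) (xs : List A) (ys : List B) →
  length (List.cartesianProductWith f xs ys) ≡ length xs * length ys
length-cartesianProductWith f List.[]         ys = refl
length-cartesianProductWith f (x List.∷ xs) ys = trans (List.length-++ (List.map (f x) ys))
  (cong₂ _+_ (List.length-map (f x) ys) (length-cartesianProductWith f xs ys))

module Circle (m : ℕ) where

  n : ℕ
  n = suc m

  N : ℕ
  N = 2 * n

  instance
    N-nonZero : NonZero N
    N-nonZero = _

  N≡n+n : N ≡ n + n
  N≡n+n = cong (n +_) (+-identityʳ n)

  n<N : n < N
  n<N = subst (n <_) (sym N≡n+n) (m<m+n n z<s)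

  m<n : m < n
  m<n = n<1+n m

  m<N : m < N
  m<N = <-trans m<n n<N

  -- The point of O_n at residue r < N: residue 0 is -n, the residues 1, …, n are
  -- +1, …, +n and the residues n+1, …, N-1 are -1, …, -(n-1).
  pointOf : ℕ → ℤ
  pointOf zero = -[1+ m ]
  pointOf (suc r) with r <? n
  ... | yes _ = ℤ.+ suc r
  ... | no _  = -[1+ r ∸ n ]

  pos-pointOf-suc : ∀ r → pos n (pointOf (suc r)) ≡ suc r
  pos-pointOf-suc r with r <? n
  ... | yes _   = refl
  ... | no r≮n = trans (+-suc n (r ∸ n)) (cong suc (m+[n∸m]≡n (≮⇒≥ r≮n)))

  pos-pointOf : ∀ r → pos n (pointOf r) % N ≡ r % N
  pos-pointOf zero    = trans (cong (_% N) (sym N≡n+n)) (n%n≡0 N)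
  pos-pointOf (suc r) = cong (_% N) (pos-pointOf-suc r)

  pointOf-isPoint : ∀ {r} → r < N → IsPoint n (pointOf r)
  pointOf-isPoint {zero} _ = s≤s z≤n , ≤-refl
  pointOf-isPoint {suc r} r<N with r <? n
  ... | yes r<n = s≤s z≤n , r<n
  ... | no _    = s≤s z≤n , m<n+o⇒m∸n<o r n (subst (r <_) N≡n+n (<-trans (n<1+n r) r<N))

  pointAt : ℕ → ℤ
  pointAt x = pointOf (x % N)

  pointAt-isPoint : ∀ x → IsPoint n (pointAt x)
  pointAt-isPoint x = pointOf-isPoint (m%n<n x N)

  pos-pointAt : ∀ x → pos n (pointAt x) % N ≡ x % N
  pos-pointAt x = trans (pos-pointOf (x % N)) (m%n%n≡m%n x N)

  pos-bounds : ∀ p → IsPoint n p → 0 < pos n p × pos n p ≤ N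
  pos-bounds (ℤ.+ k)      (0<k , k≤n) = 0<k , ≤-trans k≤n (<⇒≤ n<N)
  pos-bounds -[1+ k ]      (_ , k<n)   = s≤s z≤n , subst (n + suc k ≤_) (sym N≡n+n) (+-monoʳ-≤ n k<n)

  pos-injective : ∀ {p q} → IsPoint n p → IsPoint n q → pos n p ≡ pos n q → p ≡ q
  pos-injective {ℤ.+ k}      {ℤ.+ l}      _ _ e = cong ℤ.+_ e
  pos-injective { -[1+ k ]} { -[1+ l ]} _ _ e = cong -[1+_] (suc-injective (+-cancelˡ-≡ n _ _ e))
  pos-injective {ℤ.+ k}      { -[1+ l ]} (_ , k≤n) _ e = ⊥-elim (<⇒≱ (subst (n <_) (sym e) (m<m+n n z<s)) k≤n)
  pos-injective { -[1+ k ]} {ℤ.+ l}      _ (_ , l≤n) e = ⊥-elim (<⇒≱ (subst (n <_) e (m<m+n n z<s)) l≤n)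

  points-≡ : ∀ {p q} → IsPoint n p → IsPoint n q → pos n p % N ≡ pos n q % N → p ≡ q
  points-≡ {p} {q} hp hq e with pos-bounds p hp | pos-bounds q hq
  ... | 0<p , p≤N | 0<q , q≤N = pos-injective {p} {q} hp hq (%-injective-pos N 0<p p≤N 0<q q≤N e)

  -- Relative coordinates around a centre residue c: ptAt c u is the point u steps
  -- clockwise from c, and rel c p is the number of clockwise steps from c to p.
  ptAt : ℕ → ℕ → ℤ
  ptAt c u = pointAt (c + u)

  rel : ℕ → ℤ → ℕ
  rel c p = (pos n p + (N ∸ c)) % N

  rel<N : ∀ c p → rel c p < N
  rel<N c p = m%n<n (pos n p + (N ∸ c)) N

  full-turn : ∀ {c} → c ≤ N → ∀ x → (c + x + (N ∸ c)) % N ≡ x % N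
  full-turn {c} c≤N x = begin
    (c + x + (N ∸ c)) % N  ≡⟨ cong (_% N) (xy∙z≈xz∙y c x (N ∸ c)) ⟩
    (c + (N ∸ c) + x) % N  ≡⟨ cong (λ z → (z + x) % N) (m+[n∸m]≡n c≤N) ⟩
    (N + x) % N            ≡⟨ cong (_% N) (+-comm N x) ⟩
    (x + N) % N            ≡⟨ [m+n]%n≡m%n x N ⟩
    x % N                  ∎
    where open ≡-Reasoning

  pos-ptAt-+ : ∀ c u t → (pos n (ptAt c u) + t) % N ≡ (c + u + t) % N
  pos-ptAt-+ c u t = begin
    (pos n (ptAt c u) + t) % N      ≡⟨ %-absorbˡ N (pos n (ptAt c u)) t ⟨
    (pos n (ptAt c u) % N + t) % N  ≡⟨ cong (λ z → (z + t) % N) (pos-pointAt (c + u)) ⟩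
    ((c + u) % N + t) % N           ≡⟨ %-absorbˡ N (c + u) t ⟩
    (c + u + t) % N                 ∎
    where open ≡-Reasoning

  rel-ptAt : ∀ {c u} → c ≤ N → u < N → rel c (ptAt c u) ≡ u
  rel-ptAt {c} {u} c≤N u<N = begin
    (pos n (ptAt c u) + (N ∸ c)) % N      ≡⟨ pos-ptAt-+ c u (N ∸ c) ⟩
    (c + u + (N ∸ c)) % N                 ≡⟨ full-turn c≤N u ⟩
    u % N                                 ≡⟨ m<n⇒m%n≡m u<N ⟩
    u                                     ∎
    where open ≡-Reasoning

  ptAt-injective : ∀ {c u v} → c ≤ N → u < N → v < N → ptAt c u ≡ ptAt c v → u ≡ v
  ptAt-injective {c} c≤N u<N v<N e =
    trans (sym (rel-ptAt c≤N u<N)) (trans (cong (rel c) e) (rel-ptAt c≤N v<N))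

  ptAt-rel : ∀ {c p} → c ≤ N → IsPoint n p → ptAt c (rel c p) ≡ p
  ptAt-rel {c} {p} c≤N hp = points-≡ (pointAt-isPoint (c + rel c p)) hp (begin
    pos n (ptAt c (rel c p)) % N    ≡⟨ pos-pointAt (c + rel c p) ⟩
    (c + rel c p) % N               ≡⟨ %-absorbʳ N c (pos n p + (N ∸ c)) ⟩
    (c + (pos n p + (N ∸ c))) % N   ≡⟨ cong (_% N) (+-assoc c (pos n p) (N ∸ c)) ⟨
    (c + pos n p + (N ∸ c)) % N     ≡⟨ full-turn c≤N (pos n p) ⟩
    pos n p % N                     ∎)
    where open ≡-Reasoning

  rel-centre : ∀ p → rel (pos n p % N) p ≡ 0
  rel-centre p = begin
    (pos n p + (N ∸ c)) % N      ≡⟨ %-absorbˡ N (pos n p) (N ∸ c) ⟨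
    (c + (N ∸ c)) % N            ≡⟨ cong (_% N) (m+[n∸m]≡n (m%n≤n (pos n p) N)) ⟩
    N % N                        ≡⟨ n%n≡0 N ⟩
    0                            ∎
    where
      c = pos n p % N
      open ≡-Reasoning

  -- The absolute value of a point and its position agree modulo n, since N is a
  -- multiple of n; hence equal absolute values force relative coordinates to agree
  -- modulo n.
  abs≡pos-mod-n : ∀ p → ∣ p ∣ % n ≡ pos n p % n
  abs≡pos-mod-n (ℤ.+ k)  = refl
  abs≡pos-mod-n -[1+ k ] = sym (trans (cong (_% n) (+-comm n (suc k))) ([m+n]%n≡m%n (suc k) n))

  abs-ptAt : ∀ c u → ∣ ptAt c u ∣ % n ≡ (c + u) % n
  abs-ptAt c u = begin
    ∣ ptAt c u ∣ % n          ≡⟨ abs≡pos-mod-n (ptAt c u) ⟩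
    pos n (ptAt c u) % n      ≡⟨ m∣n⇒o%n%m≡o%m n N (pos n (ptAt c u)) (n∣m*n 2) ⟨
    pos n (ptAt c u) % N % n  ≡⟨ cong (_% n) (pos-pointAt (c + u)) ⟩
    (c + u) % N % n           ≡⟨ m∣n⇒o%n%m≡o%m n N (c + u) (n∣m*n 2) ⟩
    (c + u) % n               ∎
    where open ≡-Reasoning

  ptAt-abs-≡ : ∀ c u v → ∣ ptAt c u ∣ ≡ ∣ ptAt c v ∣ → u % n ≡ v % n
  ptAt-abs-≡ c u v e = %-cancel-+ˡ n c (trans (sym (abs-ptAt c u)) (trans (cong (_% n) e) (abs-ptAt c v)))

  CyclicInterval : (ℕ → Set) → Set
  CyclicInterval T =
    Σ ℕ λ a → Σ ℕ λ k → a < N × k ≤ N × (∀ u → u < N → T u ⇔ (a + u) % N < k)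

  cyclic-resp : ∀ {T T′} → (∀ u → u < N → T u ⇔ T′ u) → CyclicInterval T → CyclicInterval T′
  cyclic-resp T⇔T′ (a , k , a<N , k≤N , G) =
    a , k , a<N , k≤N , λ u u<N → ⇔.trans (⇔.sym (T⇔T′ u u<N)) (G u u<N)

  offset-mod : ∀ {s q} → 0 < s → s ≤ N → q ≤ N → offset n s q ≡ (q + (N ∸ s)) % N
  offset-mod {s} {q} 0<s s≤N q≤N with s ≤ᵇ q | ≤ᵇ-reflects-≤ s q
  ... | true | ofʸ s≤q = begin
    q ∸ s              ≡⟨ m<n⇒m%n≡m (<-≤-trans (∸-monoʳ-< 0<s s≤q) q≤N) ⟨
    (q ∸ s) % N        ≡⟨ [m+n]%n≡m%n (q ∸ s) N ⟨
    (q ∸ s + N) % N    ≡⟨ cong (_% N) (+-∸-comm N s≤q) ⟨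
    (q + N ∸ s) % N    ≡⟨ cong (_% N) (+-∸-assoc q s≤N) ⟩
    (q + (N ∸ s)) % N  ∎
    where open ≡-Reasoning
  ... | false | ofⁿ s≰q = begin
    q + N ∸ s          ≡⟨ +-∸-assoc q s≤N ⟩
    q + (N ∸ s)        ≡⟨ m<n⇒m%n≡m q+[N∸s]<N ⟨
    (q + (N ∸ s)) % N  ∎
    where
      open ≡-Reasoning
      q+[N∸s]<N : q + (N ∸ s) < N
      q+[N∸s]<N = subst (q + (N ∸ s) <_) (m+[n∸m]≡n s≤N) (+-monoˡ-< (N ∸ s) (≰⇒> s≰q))

  interval⇒cyclic : ∀ {S} c → IsInterval n S → CyclicInterval (λ u → S (ptAt c u))
  interval⇒cyclic {S} c (s , k , 0<s , s≤N , k≤N , F) =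
    a , k , m%n<n (c + (N ∸ s)) N , k≤N ,
    λ u _ → subst (λ z → S (ptAt c u) ⇔ z < k) (offset-ptAt u) (F (ptAt c u) (pointAt-isPoint (c + u)))
    where
      a = (c + (N ∸ s)) % N
      offset-ptAt : ∀ u → offset n s (pos n (ptAt c u)) ≡ (a + u) % N
      offset-ptAt u = begin
        offset n s (pos n (ptAt c u))     ≡⟨ offset-mod 0<s s≤N (proj₂ (pos-bounds (ptAt c u) (pointAt-isPoint (c + u)))) ⟩
        (pos n (ptAt c u) + (N ∸ s)) % N  ≡⟨ pos-ptAt-+ c u (N ∸ s) ⟩
        (c + u + (N ∸ s)) % N             ≡⟨ cong (_% N) (xy∙z≈xz∙y c u (N ∸ s)) ⟩
        (c + (N ∸ s) + u) % N             ≡⟨ %-absorbˡ N (c + (N ∸ s)) u ⟨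
        (a + u) % N                       ∎
        where open ≡-Reasoning

  cyclic⇒interval : ∀ {S c} → c ≤ N → CyclicInterval (λ u → S (ptAt c u)) → IsInterval n S
  cyclic⇒interval {S} {c} c≤N (a , k , _ , k≤N , G) =
    N ∸ t , k , m<n⇒0<n∸m t<N , m∸n≤m N t , k≤N ,
    λ p hp → subst₂ (λ P z → P ⇔ z < k) (cong S (ptAt-rel c≤N hp)) (sym (offset-rel p hp))
                    (G (rel c p) (rel<N c p))
    where
      t = (a + (N ∸ c)) % N
      t<N : t < N
      t<N = m%n<n (a + (N ∸ c)) N
      offset-rel : ∀ p → IsPoint n p → offset n (N ∸ t) (pos n p) ≡ (a + rel c p) % N
      offset-rel p hp = begin
        offset n (N ∸ t) (pos n p)     ≡⟨ offset-mod (m<n⇒0<n∸m t<N) (m∸n≤m N t) (proj₂ (pos-bounds p hp)) ⟩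
        (pos n p + (N ∸ (N ∸ t))) % N  ≡⟨ cong (λ z → (pos n p + z) % N) (m∸[m∸n]≡n (<⇒≤ t<N)) ⟩
        (pos n p + t) % N              ≡⟨ %-absorbʳ N (pos n p) (a + (N ∸ c)) ⟩
        (pos n p + (a + (N ∸ c))) % N  ≡⟨ cong (_% N) (x∙yz≈y∙xz (pos n p) a (N ∸ c)) ⟩
        (a + (pos n p + (N ∸ c))) % N  ≡⟨ %-absorbʳ N a (pos n p + (N ∸ c)) ⟨
        (a + rel c p) % N              ∎
        where open ≡-Reasoning

  wrapped-below : ∀ {a u} → a ≤ N → u < N → N ≤ a + u → (a + u) % N < a
  wrapped-below {a} {u} a≤N u<N N≤a+u = begin-strict
    (a + u) % N  ≡⟨ %-wrap N N≤a+u (+-mono-≤-< a≤N u<N) ⟩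
    a + u ∸ N    <⟨ ∸-monoˡ-< (+-monoʳ-< a u<N) N≤a+u ⟩
    a + N ∸ N    ≡⟨ m+n∸n≡m a N ⟩
    a            ∎
    where open ≤-Reasoning

  cyclic-convex : ∀ {a k x} → a < N → (a + 0) % N < k → x < N → (a + x) % N < k →
    (∀ y → y ≤ x → (a + y) % N < k) ⊎ (∀ y → x ≤ y → y < N → (a + y) % N < k)
  cyclic-convex {a} {k} {x} a<N 0∈ x<N x∈ with a + x <? N
  ... | yes a+x<N = inj₁ λ y y≤x → begin-strict
    (a + y) % N  ≡⟨ m<n⇒m%n≡m (≤-<-trans (+-monoʳ-≤ a y≤x) a+x<N) ⟩
    a + y        ≤⟨ +-monoʳ-≤ a y≤x ⟩
    a + x        ≡⟨ m<n⇒m%n≡m a+x<N ⟨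
    (a + x) % N  <⟨ x∈ ⟩
    k            ∎
    where open ≤-Reasoning
  ... | no a+x≮N = inj₂ λ y x≤y y<N → begin-strict
    (a + y) % N  <⟨ wrapped-below (<⇒≤ a<N) y<N (≤-trans (≮⇒≥ a+x≮N) (+-monoʳ-≤ a x≤y)) ⟩
    a            ≡⟨ m<n⇒m%n≡m a<N ⟨
    a % N        ≡⟨ cong (_% N) (+-identityʳ a) ⟨
    (a + 0) % N  <⟨ 0∈ ⟩
    k            ∎
    where open ≤-Reasoning

  N∸l≡1+N∸[1+l] : ∀ {l} → l < N → N ∸ l ≡ suc (N ∸ suc l)
  N∸l≡1+N∸[1+l] l<N = +-∸-assoc 1 l<N

  ∸≤⇒≤+ : ∀ {l u} → N ∸ l ≤ u → N ≤ l + u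
  ∸≤⇒≤+ {l} N∸l≤u = ≤-trans (m≤n+m∸n N l) (+-monoʳ-≤ l N∸l≤u)

  -- The arc reaching l steps counterclockwise and r steps clockwise from the centre,
  -- in relative coordinates: {0, …, r} ∪ {N-l, …, N-1}.
  Arc : ℕ → ℕ → ℕ → Set
  Arc l r u = u ≤ r ⊎ N ∸ l ≤ u

  arc-rotated : ∀ {l r u} → l + r < N → u < N → Arc l r u ⇔ (l + u) % N < suc (l + r)
  arc-rotated {l} {r} {u} l+r<N u<N = mk⇔ to from
    where
      l≤N : l ≤ N
      l≤N = ≤-trans (m≤m+n l r) (<⇒≤ l+r<N)
      to : Arc l r u → (l + u) % N < suc (l + r)
      to (inj₁ u≤r) = s≤s (subst (_≤ l + r) (sym (m<n⇒m%n≡m l+u<N)) (+-monoʳ-≤ l u≤r))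
        where l+u<N = ≤-<-trans (+-monoʳ-≤ l u≤r) l+r<N
      to (inj₂ N∸l≤u) = <-≤-trans (wrapped-below l≤N u<N N≤l+u) (m≤n⇒m≤1+n (m≤m+n l r))
        where N≤l+u = ∸≤⇒≤+ N∸l≤u
      from : (l + u) % N < suc (l + r) → Arc l r u
      from h with l + u <? N
      ... | yes l+u<N = inj₁ (+-cancelˡ-≤ l u r (s≤s⁻¹ (subst (_< suc (l + r)) (m<n⇒m%n≡m l+u<N) h)))
      ... | no l+u≮N  = inj₂ (m≤n+o⇒m∸n≤o N l (≮⇒≥ l+u≮N))

  arc-cyclic : ∀ {l r} → l + r < N → CyclicInterval (Arc l r)
  arc-cyclic {l} {r} l+r<N =
    l , suc (l + r) , ≤-<-trans (m≤m+n l r) l+r<N , l+r<N , λ u u<N → arc-rotated l+r<N u<N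

  arc-separated : ∀ {l r u v} → l + r < n → u < N → v < N → Arc l r u → Arc l r v →
    u % n ≡ v % n → u ≡ v
  arc-separated {l} {r} {u} {v} l+r<n u<N v<N u∈ v∈ u≡v[n] = begin
    u      ≡⟨ m<n⇒m%n≡m u<N ⟨
    u % N  ≡⟨ %-cancel-+ˡ N l (begin
      (l + u) % N  ≡⟨ rotated-mod-n u u<N u∈ ⟩
      (l + u) % n  ≡⟨ %-cong-+ˡ n l u≡v[n] ⟩
      (l + v) % n  ≡⟨ rotated-mod-n v v<N v∈ ⟨
      (l + v) % N  ∎) ⟩
    v % N  ≡⟨ m<n⇒m%n≡m v<N ⟩
    v      ∎
    where
      open ≡-Reasoning
      l+r<N = <-trans l+r<n n<N
      -- inside the arc, the rotated coordinate is below n, so it is its own residue mod n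
      rotated-mod-n : ∀ w → w < N → Arc l r w → (l + w) % N ≡ (l + w) % n
      rotated-mod-n w w<N w∈ = begin
        (l + w) % N      ≡⟨ m<n⇒m%n≡m (<-≤-trans (Equivalence.to (arc-rotated l+r<N w<N) w∈) l+r<n) ⟨
        (l + w) % N % n  ≡⟨ m∣n⇒o%n%m≡o%m n N (l + w) (n∣m*n 2) ⟩
        (l + w) % n      ∎

  arc-extension : ∀ {l r x} → x < N → ¬ Arc l r x →
    CyclicInterval (λ u → u ≡ x ⊎ Arc l r u) → x ≡ suc r ⊎ x ≡ N ∸ suc l
  arc-extension {l} {r} {x} x<N x∉arc (a , k , a<N , _ , G) =
    [ clockwise , counterclockwise ]′
      (cyclic-convex a<N (Equivalence.to (G 0 z<s) (inj₂ (inj₁ z≤n))) x<N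
                     (Equivalence.to (G x x<N) (inj₁ refl)))
    where
      r<x : r < x
      r<x = ≰⇒> (x∉arc ∘ inj₁)
      x<N∸l : x < N ∸ l
      x<N∸l = ≰⇒> (x∉arc ∘ inj₂)
      l<N : l < N
      l<N = m∸n≢0⇒n<m (λ N∸l≡0 → n≮0 (subst (x <_) N∸l≡0 x<N∸l))

      z = N ∸ suc l
      z<N : z < N
      z<N = ∸-monoʳ-< z<s l<N
      x≤z : x ≤ z
      x≤z = s≤s⁻¹ (subst (x <_) (N∸l≡1+N∸[1+l] l<N) x<N∸l)

      clockwise : (∀ y → y ≤ x → (a + y) % N < k) → x ≡ suc r ⊎ x ≡ N ∸ suc l
      clockwise up-to-x with Equivalence.from (G (suc r) (≤-<-trans r<x x<N)) (up-to-x (suc r) r<x)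
      ... | inj₁ 1+r≡x            = inj₁ (sym 1+r≡x)
      ... | inj₂ (inj₁ 1+r≤r)     = ⊥-elim (1+n≰n 1+r≤r)
      ... | inj₂ (inj₂ N∸l≤1+r)   = ⊥-elim (<⇒≱ x<N∸l (≤-trans N∸l≤1+r r<x))

      counterclockwise : (∀ y → x ≤ y → y < N → (a + y) % N < k) → x ≡ suc r ⊎ x ≡ N ∸ suc l
      counterclockwise from-x with Equivalence.from (G z z<N) (from-x z x≤z z<N)
      ... | inj₁ z≡x         = inj₂ (sym z≡x)
      ... | inj₂ (inj₁ z≤r)   = ⊥-elim (<⇒≱ (<-≤-trans r<x x≤z) z≤r)
      ... | inj₂ (inj₂ N∸l≤z) = ⊥-elim (1+n≰n (subst (_≤ z) (N∸l≡1+N∸[1+l] l<N) N∸l≤z))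

  arc-clockwise-step : ∀ {l r u} → Arc l (suc r) u ⇔ (u ≡ suc r ⊎ Arc l r u)
  arc-clockwise-step {l} {r} {u} = mk⇔ to from
    where
      to : Arc l (suc r) u → u ≡ suc r ⊎ Arc l r u
      to (inj₂ N∸l≤u) = inj₂ (inj₂ N∸l≤u)
      to (inj₁ u≤1+r) with m≤n⇒m<n∨m≡n u≤1+r
      ... | inj₁ u<1+r  = inj₂ (inj₁ (s≤s⁻¹ u<1+r))
      ... | inj₂ u≡1+r  = inj₁ u≡1+r
      from : u ≡ suc r ⊎ Arc l r u → Arc l (suc r) u
      from (inj₁ refl)         = inj₁ ≤-refl
      from (inj₂ (inj₁ u≤r))   = inj₁ (m≤n⇒m≤1+n u≤r)
      from (inj₂ (inj₂ N∸l≤u)) = inj₂ N∸l≤u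

  arc-counterclockwise-step : ∀ {l r u} → l < N → Arc (suc l) r u ⇔ (u ≡ N ∸ suc l ⊎ Arc l r u)
  arc-counterclockwise-step {l} {r} {u} l<N = mk⇔ to from
    where
      to : Arc (suc l) r u → u ≡ N ∸ suc l ⊎ Arc l r u
      to (inj₁ u≤r) = inj₂ (inj₁ u≤r)
      to (inj₂ N∸[1+l]≤u) with m≤n⇒m<n∨m≡n N∸[1+l]≤u
      ... | inj₁ N∸[1+l]<u = inj₂ (inj₂ (subst (_≤ u) (sym (N∸l≡1+N∸[1+l] l<N)) N∸[1+l]<u))
      ... | inj₂ N∸[1+l]≡u = inj₁ (sym N∸[1+l]≡u)
      from : u ≡ N ∸ suc l ⊎ Arc l r u → Arc (suc l) r u
      from (inj₁ refl)         = inj₂ ≤-refl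
      from (inj₂ (inj₁ u≤r))   = inj₁ u≤r
      from (inj₂ (inj₂ N∸l≤u)) = inj₂ (≤-trans (∸-monoʳ-≤ N (n≤1+n l)) N∸l≤u)

  -- A vector of choices describes a growing arc: true is a clockwise step, false a
  -- counterclockwise one.  cw and ccw count the two kinds of steps.
  cw : ∀ {k} → Vec Bool k → ℕ
  cw []           = 0
  cw (true ∷ bs)  = suc (cw bs)
  cw (false ∷ bs) = cw bs

  ccw : ∀ {k} → Vec Bool k → ℕ
  ccw []           = 0
  ccw (true ∷ bs)  = ccw bs
  ccw (false ∷ bs) = suc (ccw bs)

  steps-sum : ∀ {k} (bs : Vec Bool k) → ccw bs + cw bs ≡ k
  steps-sum []           = refl
  steps-sum (true ∷ bs)  = trans (+-suc (ccw bs) (cw bs)) (cong suc (steps-sum bs))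
  steps-sum (false ∷ bs) = cong suc (steps-sum bs)

  cw≤k : ∀ {k} (bs : Vec Bool k) → cw bs ≤ k
  cw≤k bs = subst (cw bs ≤_) (steps-sum bs) (m≤n+m (cw bs) (ccw bs))

  ccw≤k : ∀ {k} (bs : Vec Bool k) → ccw bs ≤ k
  ccw≤k bs = subst (ccw bs ≤_) (steps-sum bs) (m≤m+n (ccw bs) (cw bs))

  ArcOf : ∀ {k} → Vec Bool k → ℕ → Set
  ArcOf bs = Arc (ccw bs) (cw bs)

  newEnd : ∀ {k} → Bool → Vec Bool k → ℕ
  newEnd true  bs = suc (cw bs)
  newEnd false bs = N ∸ suc (ccw bs)

  arc-step : ∀ {k} b (bs : Vec Bool k) → k < N →
    ∀ {u} → ArcOf (b ∷ bs) u ⇔ (u ≡ newEnd b bs ⊎ ArcOf bs u)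
  arc-step true  bs _   = arc-clockwise-step {ccw bs} {cw bs}
  arc-step false bs k<N = arc-counterclockwise-step {ccw bs} {cw bs} (≤-<-trans (ccw≤k bs) k<N)

  newEnd-fresh : ∀ {k} b (bs : Vec Bool k) → suc k < N → ¬ ArcOf bs (newEnd b bs)
  newEnd-fresh true bs _ (inj₁ 1+cw≤cw) = 1+n≰n 1+cw≤cw
  newEnd-fresh true bs 1+k<N (inj₂ N∸ccw≤1+cw) =
    <⇒≱ 1+k<N (subst (N ≤_) (trans (+-suc (ccw bs) (cw bs)) (cong suc (steps-sum bs)))
                     (∸≤⇒≤+ N∸ccw≤1+cw))
  newEnd-fresh false bs 1+k<N (inj₁ N∸[1+ccw]≤cw) =
    <⇒≱ 1+k<N (subst (N ≤_) (cong suc (steps-sum bs)) (∸≤⇒≤+ N∸[1+ccw]≤cw))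
  newEnd-fresh false bs 1+k<N (inj₂ N∸ccw≤N∸[1+ccw]) =
    1+n≰n (subst (_≤ N ∸ suc (ccw bs)) (N∸l≡1+N∸[1+l] ccw<N) N∸ccw≤N∸[1+ccw])
    where ccw<N = ≤-<-trans (ccw≤k bs) (<-trans (n<1+n _) 1+k<N)

  arcSeq : ∀ {k} → Vec Bool k → Vec ℕ (suc k)
  arcSeq []       = 0 ∷ []
  arcSeq (b ∷ bs) = newEnd b bs ∷ arcSeq bs

  arcSeq-last : ∀ {k} (bs : Vec Bool k) → lookup (arcSeq bs) (fromℕ k) ≡ 0
  arcSeq-last []       = refl
  arcSeq-last (b ∷ bs) = arcSeq-last bs

  arcSeq-<N : ∀ {k} (bs : Vec Bool k) → k < N → ∀ i → lookup (arcSeq bs) i < N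
  arcSeq-<N []           _     zero    = z<s
  arcSeq-<N (true ∷ bs)  1+k<N zero    = ≤-<-trans (s≤s (cw≤k bs)) 1+k<N
  arcSeq-<N (false ∷ bs) 1+k<N zero    = ∸-monoʳ-< z<s (≤-trans (s≤s (ccw≤k bs)) (<⇒≤ 1+k<N))
  arcSeq-<N (b ∷ bs)     1+k<N (suc i) = arcSeq-<N bs (<-trans (n<1+n _) 1+k<N) i

  arcSeq-contents : ∀ {k} (bs : Vec Bool k) → k < N → ∀ u → u < N → Occurs (arcSeq bs) u ⇔ ArcOf bs u
  arcSeq-contents [] _ u u<N = mk⇔ (λ { (zero , refl) → inj₁ z≤n }) from
    where
      from : ArcOf [] u → Occurs (0 ∷ []) u
      from (inj₁ u≤0) = zero , sym (n≤0⇒n≡0 u≤0)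
      from (inj₂ N≤u) = ⊥-elim (<⇒≱ u<N N≤u)
  arcSeq-contents (b ∷ bs) 1+k<N u u<N =
    ⇔.trans occurs-cons (⇔.trans (⇔.refl ⊎-⇔ arcSeq-contents bs k<N u u<N) (⇔.sym (arc-step b bs k<N)))
    where k<N = <-trans (n<1+n _) 1+k<N

  newEnd-not-later : ∀ {k} b (bs : Vec Bool k) → suc k < N → ¬ Occurs (arcSeq bs) (newEnd b bs)
  newEnd-not-later b bs 1+k<N = newEnd-fresh b bs 1+k<N ∘
    Equivalence.to (arcSeq-contents bs (<-trans (n<1+n _) 1+k<N) (newEnd b bs) (arcSeq-<N (b ∷ bs) 1+k<N zero))

  arcSeq-distinct : ∀ {k} (bs : Vec Bool k) → k < N → Distinct (arcSeq bs)
  arcSeq-distinct bs       _     zero    zero    _ = refl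
  arcSeq-distinct (b ∷ bs) 1+k<N zero    (suc j) e = ⊥-elim (newEnd-not-later b bs 1+k<N (j , sym e))
  arcSeq-distinct (b ∷ bs) 1+k<N (suc i) zero    e = ⊥-elim (newEnd-not-later b bs 1+k<N (i , e))
  arcSeq-distinct (b ∷ bs) 1+k<N (suc i) (suc j) e =
    cong suc (arcSeq-distinct bs (<-trans (n<1+n _) 1+k<N) i j e)

  arcSeq-suffixes : ∀ {k} (bs : Vec Bool k) → k < N → ∀ j → CyclicInterval (SuffixOf (arcSeq bs) j)
  arcSeq-suffixes bs k<N zero =
    cyclic-resp (λ u u<N → ⇔.trans (⇔.sym (arcSeq-contents bs k<N u u<N))
                                   (⇔.sym (suffix-zero {v = arcSeq bs})))
                (arc-cyclic (subst (_< N) (sym (steps-sum bs)) k<N))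
  arcSeq-suffixes (b ∷ bs) 1+k<N (suc j) =
    cyclic-resp (λ _ _ → ⇔.sym suffix-suc) (arcSeq-suffixes bs (<-trans (n<1+n _) 1+k<N) j)

  -- While the arc has fewer than n points, clockwise ends lie below n and
  -- counterclockwise ends at or above n, so each step can be read off its residue.
  newEnd-decode : ∀ {k} b (bs : Vec Bool k) → suc k < n → (newEnd b bs <ᵇ n) ≡ b
  newEnd-decode true bs 1+k<n with newEnd true bs <ᵇ n | <ᵇ-reflects-< (newEnd true bs) n
  ... | true  | _      = refl
  ... | false | ofⁿ ≮n = ⊥-elim (≮n (≤-<-trans (s≤s (cw≤k bs)) 1+k<n))
  newEnd-decode false bs 1+k<n with newEnd false bs <ᵇ n | <ᵇ-reflects-< (newEnd false bs) n
  ... | false | _      = refl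
  ... | true  | ofʸ <n = ⊥-elim (<⇒≱ <n n≤N∸[1+ccw])
    where
      n≤N∸[1+ccw] : n ≤ N ∸ suc (ccw bs)
      n≤N∸[1+ccw] = subst (_≤ N ∸ suc (ccw bs)) (trans (cong (_∸ n) N≡n+n) (m+n∸n≡m n n))
                          (∸-monoʳ-≤ N (≤-trans (s≤s (ccw≤k bs)) (<⇒≤ 1+k<n)))

  decode : ∀ {k} → Vec ℕ (suc k) → Vec Bool k
  decode {zero}  _        = []
  decode {suc k} (x ∷ xs) = (x <ᵇ n) ∷ decode xs

  decode-arcSeq : ∀ {k} (bs : Vec Bool k) → k < n → decode (arcSeq bs) ≡ bs
  decode-arcSeq []       _     = refl
  decode-arcSeq (b ∷ bs) 1+k<n =
    cong₂ _∷_ (newEnd-decode b bs 1+k<n) (decode-arcSeq bs (<-trans (n<1+n _) 1+k<n))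

  arcSeq-extension : ∀ {k x} (bs : Vec Bool k) → suc k < n → x < N → ¬ Occurs (arcSeq bs) x →
    CyclicInterval (Occurs (x ∷ arcSeq bs)) → x ≡ newEnd (x <ᵇ n) bs
  arcSeq-extension {k} {x} bs 1+k<n x<N x∉ cyc =
    [ decoded true , decoded false ]′ (arc-extension {ccw bs} {cw bs} x<N x∉arc (cyclic-resp contents cyc))
    where
      k<N = <-trans (<-trans (n<1+n k) 1+k<n) n<N
      x∉arc : ¬ ArcOf bs x
      x∉arc = x∉ ∘ Equivalence.from (arcSeq-contents bs k<N x x<N)
      contents : ∀ u → u < N → Occurs (x ∷ arcSeq bs) u ⇔ (u ≡ x ⊎ ArcOf bs u)
      contents u u<N = ⇔.trans occurs-cons (⇔.refl ⊎-⇔ arcSeq-contents bs k<N u u<N)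
      decoded : ∀ b → x ≡ newEnd b bs → x ≡ newEnd (x <ᵇ n) bs
      decoded b x≡end = trans x≡end (cong (λ b′ → newEnd b′ bs) (sym x-decodes))
        where x-decodes = trans (cong (_<ᵇ n) x≡end) (newEnd-decode b bs 1+k<n)

  arcSeq-complete : ∀ {k} (us : Vec ℕ (suc k)) → k < n → (∀ i → lookup us i < N) →
    lookup us (fromℕ k) ≡ 0 → Distinct us → (∀ j → CyclicInterval (SuffixOf us j)) →
    us ≡ arcSeq (decode us)
  arcSeq-complete {zero}  (x ∷ []) _ _ x≡0 _ _ = cong (_∷ []) x≡0
  arcSeq-complete {suc k} (x ∷ xs) 1+k<n us<N last≡0 dist cyc = cong₂ _∷_ x≡newEnd xs≡arcSeq
    where
      xs≡arcSeq : xs ≡ arcSeq (decode xs)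
      xs≡arcSeq = arcSeq-complete xs (<-trans (n<1+n k) 1+k<n) (us<N ∘ suc) last≡0 (distinct-tail dist)
                    (λ j → cyclic-resp (λ _ _ → suffix-suc) (cyc (suc j)))
      x≡newEnd : x ≡ newEnd (x <ᵇ n) (decode xs)
      x≡newEnd = arcSeq-extension (decode xs) 1+k<n (us<N zero)
        (subst (λ v → ¬ Occurs v x) xs≡arcSeq (distinct-head dist))
        (subst (λ v → CyclicInterval (Occurs (x ∷ v))) xs≡arcSeq
               (cyclic-resp (λ _ _ → suffix-zero {v = x ∷ xs}) (cyc zero)))

  suffix-ptAt : ∀ {c k} → c ≤ N → (us : Vec ℕ k) → (∀ i → lookup us i < N) → ∀ j u → u < N →
    SuffixOf (map (ptAt c) us) j (ptAt c u) ⇔ SuffixOf us j u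
  suffix-ptAt {c} c≤N us us<N j u u<N = mk⇔
    (λ (i , j≤i , e) → i , j≤i , ptAt-injective c≤N (us<N i) u<N (trans (sym (lookup-map i (ptAt c) us)) e))
    (λ (i , j≤i , e) → i , j≤i , trans (lookup-map i (ptAt c) us) (cong (ptAt c) e))

  encode : Fin N → Vec Bool m → Vec ℤ n
  encode c bs = map (ptAt (toℕ c)) (arcSeq bs)

  encode-signedPerm : ∀ c bs → IsSignedPerm n (encode c bs)
  encode-signedPerm c bs = points , abs-distinct
    where
      c′ = toℕ c
      us = arcSeq bs
      us<N = arcSeq-<N bs m<N
      entry : ∀ i → lookup (encode c bs) i ≡ ptAt c′ (lookup us i)
      entry i = lookup-map i (ptAt c′) us
      in-arc : ∀ i → ArcOf bs (lookup us i)
      in-arc i = Equivalence.to (arcSeq-contents bs m<N (lookup us i) (us<N i)) (i , refl)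
      points : ∀ i → IsPoint n (lookup (encode c bs) i)
      points i = subst (IsPoint n) (sym (entry i)) (pointAt-isPoint (c′ + lookup us i))
      -- equal absolute values give congruent coordinates in an arc of at most n points
      abs-distinct : ∀ i j → ∣ lookup (encode c bs) i ∣ ≡ ∣ lookup (encode c bs) j ∣ → i ≡ j
      abs-distinct i j e = arcSeq-distinct bs m<N i j
        (arc-separated (subst (_< n) (sym (steps-sum bs)) m<n) (us<N i) (us<N j) (in-arc i) (in-arc j)
          (ptAt-abs-≡ c′ (lookup us i) (lookup us j) (subst₂ (λ p q → ∣ p ∣ ≡ ∣ q ∣) (entry i) (entry j) e)))

  encode-bArc : ∀ c bs → IsBArc n (encode c bs)
  encode-bArc c bs j = cyclic⇒interval c≤N
    (cyclic-resp (λ u u<N → ⇔.sym (suffix-ptAt c≤N (arcSeq bs) (arcSeq-<N bs m<N) j u u<N))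
                 (arcSeq-suffixes bs m<N j))
    where c≤N = <⇒≤ (Fin.toℕ<n c)

  centre : Vec ℤ n → Fin N
  centre w = fromℕ< (m%n<n (pos n (lookup w (fromℕ m))) N)

  toℕ-centre : ∀ w → toℕ (centre w) ≡ pos n (lookup w (fromℕ m)) % N
  toℕ-centre w = Fin.toℕ-fromℕ< (m%n<n (pos n (lookup w (fromℕ m))) N)

  steps : Vec ℤ n → Vec Bool m
  steps w = decode (map (rel (toℕ (centre w))) w)

  -- Every B-arc permutation is encoded by its centre and its step choices: its
  -- relative coordinates satisfy the hypotheses of arcSeq-complete.
  encode-complete : ∀ w → IsSignedPerm n w → IsBArc n w → w ≡ encode (centre w) (steps w)
  encode-complete w (points , abs-distinct) bArc =
    trans (sym w≡ptAt-us) (cong (map (ptAt c)) (arcSeq-complete us m<n us<N us-last us-distinct us-suffixes))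
    where
      c = toℕ (centre w)
      c≤N : c ≤ N
      c≤N = <⇒≤ (Fin.toℕ<n (centre w))
      us = map (rel c) w
      coord : ∀ i → lookup us i ≡ rel c (lookup w i)
      coord i = lookup-map i (rel c) w
      us<N : ∀ i → lookup us i < N
      us<N i = subst (_< N) (sym (coord i)) (rel<N c (lookup w i))
      w≡ptAt-us : map (ptAt c) us ≡ w
      w≡ptAt-us = map-inverse w (λ i → ptAt-rel c≤N (points i))
      us-last : lookup us (fromℕ m) ≡ 0
      us-last = begin
        lookup us (fromℕ m)                                  ≡⟨ coord (fromℕ m) ⟩
        rel c (lookup w (fromℕ m))                           ≡⟨ cong (λ c′ → rel c′ (lookup w (fromℕ m))) (toℕ-centre w) ⟩
        rel (pos n (lookup w (fromℕ m)) % N) (lookup w (fromℕ m))  ≡⟨ rel-centre (lookup w (fromℕ m)) ⟩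
        0                                                    ∎
        where open ≡-Reasoning
      us-distinct : Distinct us
      us-distinct i j e = abs-distinct i j (cong ∣_∣ (begin
        lookup w i                  ≡⟨ ptAt-rel c≤N (points i) ⟨
        ptAt c (rel c (lookup w i)) ≡⟨ cong (ptAt c) (trans (sym (coord i)) (trans e (coord j))) ⟩
        ptAt c (rel c (lookup w j)) ≡⟨ ptAt-rel c≤N (points j) ⟩
        lookup w j                  ∎))
        where open ≡-Reasoning
      us-suffixes : ∀ j → CyclicInterval (SuffixOf us j)
      us-suffixes j = cyclic-resp (λ u u<N → suffix-ptAt c≤N us us<N j u u<N)
        (interval⇒cyclic c (subst (λ v → IsInterval n (Suffix n v j)) (sym w≡ptAt-us) (bArc j)))

  centre-encode : ∀ c bs → centre (encode c bs) ≡ c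
  centre-encode c bs = Fin.toℕ-injective (begin
    toℕ (centre (encode c bs))                   ≡⟨ toℕ-centre (encode c bs) ⟩
    pos n (lookup (encode c bs) (fromℕ m)) % N   ≡⟨ cong (λ p → pos n p % N) (lookup-map (fromℕ m) (ptAt c′) (arcSeq bs)) ⟩
    pos n (ptAt c′ (lookup (arcSeq bs) (fromℕ m))) % N  ≡⟨ cong (λ u → pos n (ptAt c′ u) % N) (arcSeq-last bs) ⟩
    pos n (ptAt c′ 0) % N  ≡⟨ pos-pointAt (c′ + 0) ⟩
    (c′ + 0) % N           ≡⟨ cong (_% N) (+-identityʳ c′) ⟩
    c′ % N                 ≡⟨ m<n⇒m%n≡m (Fin.toℕ<n c) ⟩
    c′                     ∎)
    where
      c′ = toℕ c
      open ≡-Reasoning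

  steps-encode : ∀ c bs → steps (encode c bs) ≡ bs
  steps-encode c bs = begin
    decode (map (rel (toℕ (centre (encode c bs)))) (encode c bs))
      ≡⟨ cong (λ c″ → decode (map (rel (toℕ c″)) (encode c bs))) (centre-encode c bs) ⟩
    decode (map (rel (toℕ c)) (map (ptAt (toℕ c)) (arcSeq bs)))
      ≡⟨ cong decode (map-inverse (arcSeq bs) (λ i → rel-ptAt (<⇒≤ (Fin.toℕ<n c)) (arcSeq-<N bs m<N i))) ⟩
    decode (arcSeq bs)
      ≡⟨ decode-arcSeq bs m<n ⟩
    bs ∎
    where open ≡-Reasoning

  encode-injective : ∀ {c c′ bs bs′} → encode c bs ≡ encode c′ bs′ → c ≡ c′ × bs ≡ bs′
  encode-injective {c} {c′} {bs} {bs′} e =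
    trans (sym (centre-encode c bs)) (trans (cong centre e) (centre-encode c′ bs′)) ,
    trans (sym (steps-encode c bs)) (trans (cong steps e) (steps-encode c′ bs′))

  bArcs : List (Vec ℤ n)
  bArcs = List.cartesianProductWith encode (List.allFin N) (boolVecs m)

  bArcs-unique : Unique bArcs
  bArcs-unique =
    Unique.cartesianProductWith⁺ encode encode-injective (Unique.allFin⁺ N) (boolVecs-unique m)

  bArcs-members : ∀ w → (w ∈ bArcs) ⇔ (IsSignedPerm n w × IsBArc n w)
  bArcs-members w = mk⇔ sound complete
    where
      sound : w ∈ bArcs → IsSignedPerm n w × IsBArc n w
      sound w∈ with ∈-cartesianProductWith⁻ encode (List.allFin N) (boolVecs m) w∈
      ... | c , bs , _ , _ , refl = encode-signedPerm c bs , encode-bArc c bs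
      complete : IsSignedPerm n w × IsBArc n w → w ∈ bArcs
      complete (signed , bArc) = subst (_∈ bArcs) (sym (encode-complete w signed bArc))
        (∈-cartesianProductWith⁺ encode (∈-allFin (centre w)) (boolVecs-complete (steps w)))

  bArcs-length : length bArcs ≡ n * 2 ^ n
  bArcs-length = begin
    length bArcs                                  ≡⟨ length-cartesianProductWith encode (List.allFin N) (boolVecs m) ⟩
    length (List.allFin N) * length (boolVecs m)  ≡⟨ cong₂ _*_ (List.length-tabulate {n = N} (λ i → i))
                                                               (boolVecs-length m) ⟩
    2 * n * 2 ^ m                  ≡⟨ cong (_* 2 ^ m) (*-comm 2 n) ⟩
    n * 2 * 2 ^ m                  ≡⟨ *-assoc n 2 (2 ^ m) ⟩
    n * 2 ^ n                      ∎
    where open ≡-Reasoning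

claim5p4 : (n : ℕ) → 1 ≤ n →
    Σ (List (Vec ℤ n)) λ L →
      Unique L ×
      (∀ (w : Vec ℤ n) → (w ∈ L) ⇔ (IsSignedPerm n w × IsBArc n w)) ×
      length L ≡ n * 2 ^ n
claim5p4 zero    ()
claim5p4 (suc m) _ = bArcs , bArcs-unique , bArcs-members , bArcs-length
  where open Circle m
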